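{- If $G$ and $H$ are vertex-disjoint finite graphs, then $Z_{G\cup H}(q,t)=Z_G(q,t)\,Z_H(q,t)$.
   Context: For a finite graph $G=(V,E)$ (loops and multiple edges allowed), let $\Pi_V$ be the set of set partitions of $V$. For $e\in E$ and $\pi\in\Pi_V$ write $e\prec\pi$ if some block of $\pi$ contains both ends of $e$, and let $\langle G:\pi\rangle:=\#\{e\in E: e\not\prec\pi\}$. Define $Z_G(q,t):=\sum_{\pi\in\Pi_V}q^{\langle G:\pi\rangle}t_{(\#\pi)}$, where $t_{(k)}=t(t-1)\cdots(t-k+1)$ and $\#\pi$ is the number of blocks. -}

module Defs where

open import Level using (Level)
open import Data.Nat using (ℕ; zero; suc)
open import Data.Nat as ℕ using ()
open import Data.Fin using (Fin; zero; suc; _↑ˡ_; _↑ʳ_)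
import Data.Fin.Properties as FinP
open import Data.Product using (_×_; _,_)
open import Data.List using (List; []; _∷_; map; length; filter; concatMap; foldr; _++_)
open import Data.List.Relation.Unary.Any using (Any; any?)
open import Data.List.Membership.Propositional using (_∈_)
import Data.List.Membership.DecPropositional as DMP
open import Relation.Nullary using (¬_; ¬?)
open import Relation.Nullary.Decidable using (Dec; _×-dec_)
open import Algebra.Bundles using (CommutativeRing)

-- A finite graph on vertex set Fin n, loops and multiple edges allowed:
-- a finite list (multiset) of edges, each given by its two ends.
record Graph (n : ℕ) : Set where
  constructor graph
  field
    edges : List (Fin n × Fin n)
open Graph public

_⊎G_ : ∀ {m k} → Graph m → Graph k → Graph (m ℕ.+ k)
_⊎G_ {m} {k} G H =
  graph (map (λ { (u , v) → (u ↑ˡ k , v ↑ˡ k) }) (edges G)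
      ++ map (λ { (u , v) → (m ↑ʳ u , m ↑ʳ v) }) (edges H))

-- A set partition of Fin n, represented as a list of (nonempty) blocks.
Partition : ℕ → Set
Partition n = List (List (Fin n))

private
  insertEach : ∀ {n} → Partition (suc n) → List (Partition (suc n))
  insertEach [] = []
  insertEach (B ∷ π) = ((zero ∷ B) ∷ π) ∷ map (B ∷_) (insertEach π)

-- Standard recursion: a partition of {0,...,n} is obtained from a partition
-- of {1,...,n} by either adding {0} as a new singleton block or adding 0
-- to one of the existing blocks.
partitions : (n : ℕ) → List (Partition n)
partitions zero = [] ∷ []
partitions (suc n) =
  concatMap (λ π → let π' = map (map suc) π in ((zero ∷ []) ∷ π') ∷ insertEach π')
            (partitions n)

#blocks : ∀ {n} → Partition n → ℕ
#blocks = length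

_≺_ : ∀ {n} → Fin n × Fin n → Partition n → Set
(u , v) ≺ π = Any (λ B → (u ∈ B) × (v ∈ B)) π

_≺?_ : ∀ {n} (e : Fin n × Fin n) (π : Partition n) → Dec (e ≺ π)
_≺?_ {n} (u , v) π = any? (λ B → (u ∈? B) ×-dec (v ∈? B)) π
  where open DMP (FinP._≟_ {n}) using (_∈?_)

⟨_∶_⟩ : ∀ {n} → Graph n → Partition n → ℕ
⟨ G ∶ π ⟩ = length (filter (λ e → ¬? (e ≺? π)) (edges G))

module _ {c ℓ : Level} (R : CommutativeRing c ℓ) where
  open CommutativeRing R

  pow : Carrier → ℕ → Carrier
  pow x zero = 1#
  pow x (suc k) = pow x k * x

  falling : Carrier → ℕ → Carrier
  falling t zero = 1#
  falling t (suc k) = falling t k * (t - fromℕ k)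
    where
      fromℕ : ℕ → Carrier
      fromℕ zero = 0#
      fromℕ (suc j) = 1# + fromℕ j

  sumR : List Carrier → Carrier
  sumR = foldr _+_ 0#

  Z : ∀ {n} → Graph n → Carrier → Carrier → Carrier
  Z {n} G q t = sumR (map (λ π → pow q ⟨ G ∶ π ⟩ * falling t (#blocks π)) (partitions n))

-- Build the partitions of the vertices of G ⊎ H by first partitioning H (into τ) and then adding the
-- vertices of G one at a time. The H-edges then contribute q^⟨H:τ⟩, and everything else depends only
-- on the trace of the partition on G, in which the blocks of τ survive as #τ distinguished, possibly
-- empty blocks. So it suffices that Σ_σ W(σ) t_(#σ) = t_(#τ) Σ_ρ W(ρ) t_(#ρ), σ ranging over partitions
-- of G with #τ such initial blocks and ρ over plain partitions, for every weight W that only depends on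
-- the underlying set partition. This goes by induction on the number of vertices: summing out the newest
-- vertex turns W into another such weight, because t_(j+1) = t_(j) (t - j) and putting the vertex into
-- an empty block contributes exactly what opening a new block loses.
module Submission where

open import Defs
open import Level using (Level)
open import Function.Base using (_∘_)
open import Function.Bundles using (_⇔_; mk⇔; Equivalence)
open Equivalence using (to; from)
open import Function.Properties.Equivalence using () renaming (refl to ⇔-refl; trans to ⇔-trans)
open import Algebra.Bundles using (CommutativeRing)
open import Data.Nat using (ℕ; zero; suc)
import Data.Nat as ℕ
open import Data.Nat.Properties using (+-suc)
open import Data.Fin using (Fin; zero; suc; _↑ˡ_; _↑ʳ_; splitAt)
open import Data.Fin.Properties using (splitAt-↑ˡ; splitAt⁻¹-↑ˡ)
open import Data.Maybe using (Maybe; just; nothing)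
import Data.Maybe as Maybe
import Data.Maybe.Relation.Unary.Any as MaybeAny
open import Data.Sum using (inj₁; inj₂; isInj₁)
open import Data.Product using (_×_; _,_; proj₁)
open import Data.List using (List; []; _∷_; map; length; filter; concatMap; mapMaybe; drop; _++_)
open import Data.List.Properties
  using (concatMap-cong; concatMap-pure; concatMap-map; map-concatMap; mapMaybe-map; mapMaybe-cong
        ; map-mapMaybe; mapMaybe-map-retract; filter-++; length-++; length-map; map-id; map-∘)
open import Data.List.Effectful using (module MonadProperties)
open import Data.List.Relation.Unary.Any using (Any; here; there)
import Data.List.Relation.Unary.Any as Any
import Data.List.Relation.Unary.Any.Properties as Any
open import Data.List.Relation.Unary.All using (All; []; _∷_)
import Data.List.Relation.Unary.All as All
import Data.List.Relation.Unary.All.Properties as All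
open import Data.List.Membership.Propositional using (_∈_)
open import Relation.Nullary using (¬_; yes; no; contradiction)
open import Relation.Binary.PropositionalEquality
  using (_≡_; _≗_; refl; sym; trans; cong; cong₂; module ≡-Reasoning)

private variable
  A C : Set
  a b n m k : ℕ

shift : Partition n → Partition (suc n)
shift = map (map suc)

newBlock : Partition n → Partition (suc n)
newBlock π = (zero ∷ []) ∷ shift π

insert : Partition (suc n) → List (Partition (suc n))
insert [] = []
insert (B ∷ π) = ((zero ∷ B) ∷ π) ∷ map (B ∷_) (insert π)

step : Partition n → List (Partition (suc n))
step π = newBlock π ∷ insert (shift π)

-- `partitions` uses a private copy of `insert`; it is identified with ours through the defining equations.
step-unique : (f : Partition n → List (Partition (suc n))) → f [] ≡ step [] →
  (∀ B π → f (B ∷ π) ≡ newBlock (B ∷ π) ∷ ((zero ∷ map suc B) ∷ shift π) ∷ map (map suc B ∷_) (drop 1 (f π))) →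
  f ≗ step
step-unique f f[] f∷ [] = f[]
step-unique f f[] f∷ (B ∷ π) =
  trans (f∷ B π) (cong (λ πs → _ ∷ _ ∷ map (map suc B ∷_) (drop 1 πs)) (step-unique f f[] f∷ π))

partitions-suc : ∀ n → partitions (suc n) ≡ concatMap step (partitions n)
partitions-suc n = concatMap-cong (step-unique _ refl (λ _ _ → refl)) (partitions n)

extensions : ∀ m → Partition k → List (Partition (m ℕ.+ k))
extensions zero τ = τ ∷ []
extensions (suc m) τ = concatMap step (extensions m τ)

partitions-+ : ∀ m k → partitions (m ℕ.+ k) ≡ concatMap (extensions m) (partitions k)
partitions-+ zero k = sym (concatMap-pure (partitions k))
partitions-+ (suc m) k = begin
  partitions (suc m ℕ.+ k)                                 ≡⟨ partitions-suc (m ℕ.+ k) ⟩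
  concatMap step (partitions (m ℕ.+ k))                    ≡⟨ cong (concatMap step) (partitions-+ m k) ⟩
  concatMap step (concatMap (extensions m) (partitions k)) ≡⟨ MonadProperties.associative (partitions k) (extensions m) step ⟨
  concatMap (extensions (suc m)) (partitions k)            ∎
  where open ≡-Reasoning

-- A partition of Fin 0 is a list of empty blocks, which are carried along as distinguished blocks.
partitionsWith : ∀ m → Partition 0 → List (Partition m)
partitionsWith zero ρ = ρ ∷ []
partitionsWith (suc m) ρ = concatMap step (partitionsWith m ρ)

length-insert : (ρ : Partition (suc n)) → All (λ π → length π ≡ length ρ) (insert ρ)
length-insert [] = []
length-insert (B ∷ ρ) = refl ∷ All.map⁺ (All.map (cong suc) (length-insert ρ))

All-concatMap : {P : C → Set} (f : A → List C) {xs : List A} → All (All P ∘ f) xs → All P (concatMap f xs)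
All-concatMap f = All.concat⁺ ∘ All.map⁺

infix 4 _⇝_

-- Elementary moves between two lists of blocks presenting the same set partition.
data _⇝_ {A : Set} : List (List A) → List (List A) → Set where
  swap      : ∀ {B C σ} → B ∷ C ∷ σ ⇝ C ∷ B ∷ σ
  dropEmpty : ∀ {σ} → [] ∷ σ ⇝ σ
  prep      : ∀ {B σ μ} → σ ⇝ μ → B ∷ σ ⇝ B ∷ μ

⇝-map : ∀ {σ μ : List (List A)} (f : A → C) → σ ⇝ μ → map (map f) σ ⇝ map (map f) μ
⇝-map f swap      = swap
⇝-map f dropEmpty = dropEmpty
⇝-map f (prep p)  = prep (⇝-map f p)

Any-⇝ : ∀ {P : List A → Set} {σ μ} → ¬ P [] → σ ⇝ μ → Any P σ ⇔ Any P μ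
Any-⇝ ¬P[] swap = mk⇔ exchange exchange
  where
  exchange : ∀ {P : List A → Set} {B C σ} → Any P (B ∷ C ∷ σ) → Any P (C ∷ B ∷ σ)
  exchange (here p)          = there (here p)
  exchange (there (here p))  = here p
  exchange (there (there p)) = there (there p)
Any-⇝ ¬P[] dropEmpty = mk⇔ (λ { (here p) → contradiction p ¬P[] ; (there p) → p }) there
Any-⇝ ¬P[] (prep p) = mk⇔ (Any-∷ (to (Any-⇝ ¬P[] p))) (Any-∷ (from (Any-⇝ ¬P[] p)))
  where
  Any-∷ : ∀ {P : List A → Set} {B σ μ} → (Any P σ → Any P μ) → Any P (B ∷ σ) → Any P (B ∷ μ)
  Any-∷ f (here p)  = here p
  Any-∷ f (there p) = there (f p)

≺-⇝ : ∀ {e} {σ μ : Partition n} → σ ⇝ μ → (e ≺ σ) ⇔ (e ≺ μ)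
≺-⇝ = Any-⇝ λ ()

module _ {f : A → C} {r : C → Maybe A} (partialInverse : ∀ {x y} → r y ≡ just x ⇔ f x ≡ y) where

  ∈-mapMaybe : ∀ {x} xs → x ∈ mapMaybe r xs ⇔ f x ∈ xs
  ∈-mapMaybe {x} xs = mk⇔ (image xs) (Any.mapMaybe⁺ r xs ∘ Any.map⁺ ∘ Any.map preimage)
    where
    image : ∀ xs → x ∈ mapMaybe r xs → f x ∈ xs
    image (y ∷ ys) p with r y in ry | p
    ... | nothing | q         = there (image ys q)
    ... | just z  | here refl = here (to partialInverse ry)
    ... | just z  | there q   = there (image ys q)
    preimage : ∀ {y} → f x ≡ y → MaybeAny.Any (x ≡_) (r y)
    preimage fx≡y rewrite from partialInverse fx≡y = MaybeAny.just refl

restrict : (Fin b → Maybe (Fin a)) → Partition b → Partition a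
restrict r = map (mapMaybe r)

≺-restrict : ∀ {f : Fin a → Fin b} {r} → (∀ {x y} → r y ≡ just x ⇔ f x ≡ y) →
  ∀ {x y} (σ : Partition b) → ((f x , f y) ≺ σ) ⇔ ((x , y) ≺ restrict r σ)
≺-restrict inv σ = mk⇔ (Any.map⁺ ∘ Any.map (λ (p , q) → from (∈-mapMaybe inv _) p , from (∈-mapMaybe inv _) q))
                       (Any.map (λ (p , q) → to (∈-mapMaybe inv _) p , to (∈-mapMaybe inv _) q) ∘ Any.map⁻)

predecessor : Fin (suc n) → Maybe (Fin n)
predecessor zero    = nothing
predecessor (suc x) = just x

predecessor-inverse : ∀ {x : Fin n} {y} → predecessor y ≡ just x ⇔ suc x ≡ y
predecessor-inverse {y = zero}  = mk⇔ (λ ()) (λ ())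
predecessor-inverse {y = suc y} = mk⇔ (λ { refl → refl }) (λ { refl → refl })

remove₀ : Partition (suc n) → Partition n
remove₀ = restrict predecessor

remove₀-shift : (π : Partition n) → remove₀ (shift π) ≡ π
remove₀-shift []      = refl
remove₀-shift (B ∷ π) = cong₂ _∷_ (mapMaybe-map-retract (λ _ → refl) B) (remove₀-shift π)

remove₀-insert : (ρ : Partition (suc n)) → All (λ π → remove₀ π ≡ remove₀ ρ) (insert ρ)
remove₀-insert []      = []
remove₀-insert (B ∷ ρ) = refl ∷ All.map⁺ (All.map (cong (mapMaybe predecessor B ∷_)) (remove₀-insert ρ))

-- Removing vertex 0 from a partition in `step π` gives back π, possibly with an extra empty block.
≺-step : (π : Partition n) → All (λ π′ → ∀ x y → ((suc x , suc y) ≺ π′) ⇔ ((x , y) ≺ π)) (step π)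
≺-step π = (λ x y → ⇔-trans (≺-remove₀ (newBlock π)) (⇔-trans (≺-⇝ dropEmpty) (≺-≡ (remove₀-shift π))))
         ∷ All.map (λ eq x y → ⇔-trans (≺-remove₀ _) (≺-≡ (trans eq (remove₀-shift π)))) (remove₀-insert (shift π))
  where
  ≺-remove₀ : ∀ {x y} (π′ : Partition (suc n)) → ((suc x , suc y) ≺ π′) ⇔ ((x , y) ≺ remove₀ π′)
  ≺-remove₀ = ≺-restrict predecessor-inverse
  ≺-≡ : ∀ {e} {σ μ : Partition n} → σ ≡ μ → (e ≺ σ) ⇔ (e ≺ μ)
  ≺-≡ refl = ⇔-refl

Extends : ∀ m → Partition k → Partition (m ℕ.+ k) → Set
Extends m τ π = ∀ u v → ((m ↑ʳ u , m ↑ʳ v) ≺ π) ⇔ ((u , v) ≺ τ)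

extensions-extend : ∀ m (τ : Partition k) → All (Extends m τ) (extensions m τ)
extensions-extend zero τ    = (λ u v → ⇔-refl) ∷ []
extensions-extend (suc m) τ =
  All-concatMap step (All.map (λ hπ → All.map (λ h u v → ⇔-trans (h _ _) (hπ u v)) (≺-step _)) (extensions-extend m τ))

left : ∀ m → Fin (m ℕ.+ k) → Maybe (Fin m)
left m = isInj₁ ∘ splitAt m

left-inverse : ∀ {x : Fin m} {y : Fin (m ℕ.+ k)} → left m y ≡ just x ⇔ x ↑ˡ k ≡ y
left-inverse {m} {k} {x} {y} = mk⇔ image (λ { refl → cong isInj₁ (splitAt-↑ˡ m x k) })
  where
  image : left m y ≡ just x → x ↑ˡ k ≡ y
  image eq with splitAt m y in split
  image refl | inj₁ x = splitAt⁻¹-↑ˡ split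

restrictˡ : ∀ m → Partition (m ℕ.+ k) → Partition m
restrictˡ m = restrict (left m)

left-suc : ∀ m (y : Fin (m ℕ.+ k)) → left (suc m) (suc y) ≡ Maybe.map suc (left m y)
left-suc m y with splitAt m y
... | inj₁ x = refl
... | inj₂ z = refl

restrictˡ-shift : ∀ m (π : Partition (m ℕ.+ k)) → restrictˡ (suc m) (shift π) ≡ shift (restrictˡ m π)
restrictˡ-shift m []      = refl
restrictˡ-shift m (B ∷ π) = cong₂ _∷_ shiftBlock (restrictˡ-shift m π)
  where
  open ≡-Reasoning
  shiftBlock : mapMaybe (left (suc m)) (map suc B) ≡ map suc (mapMaybe (left m) B)
  shiftBlock = begin
    mapMaybe (left (suc m)) (map suc B)        ≡⟨ mapMaybe-map (left (suc m)) suc B ⟩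
    mapMaybe (left (suc m) ∘ suc) B            ≡⟨ mapMaybe-cong (left-suc m) B ⟩
    mapMaybe (Maybe.map suc ∘ left m) B        ≡⟨ map-mapMaybe suc (left m) B ⟨
    map suc (mapMaybe (left m) B)              ∎

restrictˡ-insert : ∀ m (ρ : Partition (suc m ℕ.+ k)) → map (restrictˡ (suc m)) (insert ρ) ≡ insert (restrictˡ (suc m) ρ)
restrictˡ-insert m []      = refl
restrictˡ-insert m (B ∷ ρ) = cong (restrictˡ (suc m) ((zero ∷ B) ∷ ρ) ∷_) (begin
  map (restrictˡ (suc m)) (map (B ∷_) (insert ρ))   ≡⟨ map-∘ (insert ρ) ⟨
  map (λ π → B′ ∷ restrictˡ (suc m) π) (insert ρ)   ≡⟨ map-∘ (insert ρ) ⟩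
  map (B′ ∷_) (map (restrictˡ (suc m)) (insert ρ))  ≡⟨ cong (map (B′ ∷_)) (restrictˡ-insert m ρ) ⟩
  map (B′ ∷_) (insert (restrictˡ (suc m) ρ))        ∎)
  where
  open ≡-Reasoning
  B′ : List (Fin (suc m))
  B′ = mapMaybe (left (suc m)) B

restrictˡ-step : ∀ m (π : Partition (m ℕ.+ k)) → map (restrictˡ (suc m)) (step π) ≡ step (restrictˡ m π)
restrictˡ-step m π = cong₂ (λ σ πs → ((zero ∷ []) ∷ σ) ∷ πs) (restrictˡ-shift m π)
  (trans (restrictˡ-insert m (shift π)) (cong insert (restrictˡ-shift m π)))

restrictˡ-extensions : ∀ m (τ : Partition k) → map (restrictˡ m) (extensions m τ) ≡ partitionsWith m (restrictˡ 0 τ)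
restrictˡ-extensions zero    τ = refl
restrictˡ-extensions (suc m) τ = begin
  map (restrictˡ (suc m)) (concatMap step (extensions m τ))  ≡⟨ map-concatMap (restrictˡ (suc m)) step (extensions m τ) ⟩
  concatMap (map (restrictˡ (suc m)) ∘ step) (extensions m τ) ≡⟨ concatMap-cong (restrictˡ-step m) (extensions m τ) ⟩
  concatMap (step ∘ restrictˡ m) (extensions m τ)             ≡⟨ concatMap-map step (restrictˡ m) (extensions m τ) ⟨
  concatMap step (map (restrictˡ m) (extensions m τ))         ≡⟨ cong (concatMap step) (restrictˡ-extensions m τ) ⟩
  partitionsWith (suc m) (restrictˡ 0 τ)                      ∎
  where open ≡-Reasoning

⟨⟩-++ : (xs ys : List (Fin n × Fin n)) (π : Partition n) →
  ⟨ graph (xs ++ ys) ∶ π ⟩ ≡ ⟨ graph xs ∶ π ⟩ ℕ.+ ⟨ graph ys ∶ π ⟩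
⟨⟩-++ xs ys π = trans (cong length (filter-++ _ xs ys)) (length-++ (filter _ xs))

⟨⟩-map : (f : Fin a × Fin a → Fin b × Fin b) {π : Partition b} {ρ : Partition a} →
  (∀ e → (f e ≺ π) ⇔ (e ≺ ρ)) → ∀ es → ⟨ graph (map f es) ∶ π ⟩ ≡ ⟨ graph es ∶ ρ ⟩
⟨⟩-map f h [] = refl
⟨⟩-map f {π} {ρ} h (e ∷ es) with f e ≺? π | e ≺? ρ
... | yes _   | yes _  = ⟨⟩-map f h es
... | no _    | no _   = cong suc (⟨⟩-map f h es)
... | yes fe≺ | no e⊀  = contradiction (to (h e) fe≺) e⊀
... | no fe⊀  | yes e≺ = contradiction (from (h e) e≺) fe⊀

⟨⟩-⇝ : (G : Graph n) {σ μ : Partition n} → σ ⇝ μ → ⟨ G ∶ σ ⟩ ≡ ⟨ G ∶ μ ⟩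
⟨⟩-⇝ G p = trans (cong (λ es → ⟨ graph es ∶ _ ⟩) (sym (map-id (edges G)))) (⟨⟩-map (λ e → e) (λ e → ≺-⇝ p) (edges G))

⟨⟩-⊎G : ∀ {m k} (G : Graph m) (H : Graph k) (τ : Partition k) (π : Partition (m ℕ.+ k)) → Extends m τ π →
  ⟨ G ⊎G H ∶ π ⟩ ≡ ⟨ G ∶ restrictˡ m π ⟩ ℕ.+ ⟨ H ∶ τ ⟩
⟨⟩-⊎G {m} {k} G H τ π hτ = trans (⟨⟩-++ (map embedˡ (edges G)) (map embedʳ (edges H)) π)
  (cong₂ ℕ._+_ (⟨⟩-map embedˡ (λ _ → ≺-restrict left-inverse π) (edges G)) (⟨⟩-map embedʳ (λ (u , v) → hτ u v) (edges H)))
  where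
  embedˡ : Fin m × Fin m → Fin (m ℕ.+ k) × Fin (m ℕ.+ k)
  embedˡ (u , v) = u ↑ˡ k , v ↑ˡ k
  embedʳ : Fin k × Fin k → Fin (m ℕ.+ k) × Fin (m ℕ.+ k)
  embedʳ (u , v) = m ↑ʳ u , m ↑ʳ v

module WeightedSums {c ℓ : Level} (R : CommutativeRing c ℓ) where
  open CommutativeRing R hiding (zero)
    renaming (refl to ≈-refl; sym to ≈-sym; trans to ≈-trans; reflexive to ≈-reflexive)
  open import Relation.Binary.Reasoning.Setoid setoid
  open import Algebra.Properties.CommutativeSemigroup +-commutativeSemigroup
    using () renaming (x∙yz≈y∙xz to x+[y+z]≈y+[x+z])
  open import Algebra.Properties.CommutativeSemigroup *-commutativeSemigroup using (xy∙z≈xz∙y; xy∙z≈y∙xz)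

  ∑ : List A → (A → Carrier) → Carrier
  ∑ xs f = sumR R (map f xs)

  syntax ∑ xs (λ x → e) = ∑[ x ∈ xs ] e

  ∑-congᴬ : ∀ {f g : A → Carrier} {xs} → All (λ x → f x ≈ g x) xs → ∑ xs f ≈ ∑ xs g
  ∑-congᴬ []       = ≈-refl
  ∑-congᴬ (p ∷ ps) = +-cong p (∑-congᴬ ps)

  ∑-cong : ∀ {f g : A → Carrier} → (∀ x → f x ≈ g x) → ∀ xs → ∑ xs f ≈ ∑ xs g
  ∑-cong f≈g xs = ∑-congᴬ (All.universal f≈g xs)

  ∑-map : (f : C → Carrier) (g : A → C) (xs : List A) → ∑ (map g xs) f ≡ ∑ xs (f ∘ g)
  ∑-map f g xs = cong (sumR R) (sym (map-∘ xs))

  ∑-++ : (f : A → Carrier) (xs ys : List A) → ∑ (xs ++ ys) f ≈ ∑ xs f + ∑ ys f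
  ∑-++ f []       ys = ≈-sym (+-identityˡ _)
  ∑-++ f (x ∷ xs) ys = ≈-trans (+-congˡ (∑-++ f xs ys)) (≈-sym (+-assoc _ _ _))

  ∑-concatMap : (f : C → Carrier) (g : A → List C) (xs : List A) → ∑ (concatMap g xs) f ≈ ∑[ x ∈ xs ] ∑ (g x) f
  ∑-concatMap f g []       = ≈-refl
  ∑-concatMap f g (x ∷ xs) = ≈-trans (∑-++ f (g x) (concatMap g xs)) (+-congˡ (∑-concatMap f g xs))

  ∑-*ˡ : (a : Carrier) (f : A → Carrier) (xs : List A) → ∑[ x ∈ xs ] (a * f x) ≈ a * ∑ xs f
  ∑-*ˡ a f []       = ≈-sym (zeroʳ a)
  ∑-*ˡ a f (x ∷ xs) = ≈-trans (+-congˡ (∑-*ˡ a f xs)) (≈-sym (distribˡ a _ _))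

  ∑-*ʳ : (a : Carrier) (f : A → Carrier) (xs : List A) → ∑[ x ∈ xs ] (f x * a) ≈ ∑ xs f * a
  ∑-*ʳ a f []       = ≈-sym (zeroˡ a)
  ∑-*ʳ a f (x ∷ xs) = ≈-trans (+-congˡ (∑-*ʳ a f xs)) (≈-sym (distribʳ a _ _))

  x-[1+y]+1≈x-y : ∀ x y → (x - (1# + y)) + 1# ≈ x - y
  x-[1+y]+1≈x-y x y = begin
    (x - (1# + y)) + 1#     ≈⟨ +-congʳ (+-congˡ (⁻¹-∙-comm 1# y)) ⟨
    (x + (- 1# - y)) + 1#   ≈⟨ +-assoc x _ 1# ⟩
    x + ((- 1# - y) + 1#)   ≈⟨ +-congˡ (+-congʳ (+-comm (- 1#) (- y))) ⟩
    x + ((- y - 1#) + 1#)   ≈⟨ +-congˡ (+-assoc (- y) (- 1#) 1#) ⟩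
    x + (- y + (- 1# + 1#)) ≈⟨ +-congˡ (+-congˡ (-‿inverseˡ 1#)) ⟩
    x + (- y + 0#)          ≈⟨ +-congˡ (+-identityʳ (- y)) ⟩
    x - y                   ∎
    where open import Algebra.Properties.AbelianGroup +-abelianGroup using (⁻¹-∙-comm)

  Weight : ℕ → Set c
  Weight n = Partition n → Carrier

  Invariant : Weight n → Set ℓ
  Invariant W = ∀ {σ μ} → σ ⇝ μ → W σ ≈ W μ

  invariant-∷ : ∀ {W : Weight n} B → Invariant W → Invariant (W ∘ (B ∷_))
  invariant-∷ B inv = inv ∘ prep

  invariant-empty : ∀ {W : Weight 0} → Invariant W → (ρ : Partition 0) → W ρ ≈ W []
  invariant-empty inv []       = ≈-refl
  invariant-empty inv ([] ∷ ρ) = ≈-trans (inv dropEmpty) (invariant-empty inv ρ)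

  module _ (t : Carrier) where

    -- The factor t - k in t₍ₖ₊₁₎ = t₍ₖ₎ (t - k); `falling` computes k by a local function, recovered here by unification.
    gap : ℕ → Carrier
    gap k = proj₁ {B = λ g → falling R t (suc k) ≡ falling R t k * g} (_ , refl)

    gap-suc : ∀ k → gap (suc k) + 1# ≈ gap k
    gap-suc k = x-[1+y]+1≈x-y t _

    weighted : Weight n → Weight n
    weighted W π = W π * falling R t (length π)

    -- The weight of σ obtained by summing over the ways of adding vertex 0, when σ follows j other blocks.
    stepWeight : ℕ → Weight (suc n) → Weight n
    stepWeight j W σ = W (newBlock σ) * gap (j ℕ.+ length σ) + ∑[ π ∈ insert (shift σ) ] W π

    ∑-step : (W : Weight (suc n)) (σ : Partition n) → ∑[ π ∈ step σ ] weighted W π ≈ weighted (stepWeight 0 W) σ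
    ∑-step W σ = begin
      W (newBlock σ) * falling R t (suc L) + ∑[ π ∈ insert (shift σ) ] (W π * falling R t (length π))
        ≈⟨ +-congˡ (∑-congᴬ (All.map (λ eq → *-congˡ (≈-reflexive (cong (falling R t) eq))) (length-insert (shift σ)))) ⟩
      W (newBlock σ) * (falling R t L * gap L) + ∑[ π ∈ insert (shift σ) ] (W π * falling R t L)
        ≈⟨ +-congˡ (∑-*ʳ _ W (insert (shift σ))) ⟩
      W (newBlock σ) * (falling R t L * gap L) + (∑[ π ∈ insert (shift σ) ] W π) * falling R t L
        ≈⟨ factor _ _ _ _ ⟩
      (W (newBlock σ) * gap L + ∑[ π ∈ insert (shift σ) ] W π) * falling R t L
        ≡⟨ cong (λ L → (W (newBlock σ) * gap L + ∑[ π ∈ insert (shift σ) ] W π) * falling R t L) (length-map (map suc) σ) ⟩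
      weighted (stepWeight 0 W) σ ∎
      where
      L : ℕ
      L = length (shift σ)
      factor : ∀ a f g s → a * (f * g) + s * f ≈ (a * g + s) * f
      factor a f g s = begin
        a * (f * g) + s * f ≈⟨ +-congʳ (*-congˡ (*-comm f g)) ⟩
        a * (g * f) + s * f ≈⟨ +-congʳ (*-assoc a g f) ⟨
        (a * g) * f + s * f ≈⟨ distribʳ f (a * g) s ⟨
        (a * g + s) * f     ∎

    stepWeight-cong : ∀ {W₁ W₂ : Weight (suc n)} → (∀ π → W₁ π ≈ W₂ π) →
      ∀ j σ → stepWeight j W₁ σ ≈ stepWeight j W₂ σ
    stepWeight-cong W₁≈W₂ j σ = +-cong (*-congʳ (W₁≈W₂ _)) (∑-cong W₁≈W₂ (insert (shift σ)))

    stepWeight-∷ : ∀ {W : Weight (suc n)} → Invariant W → ∀ j B σ →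
      stepWeight j W (B ∷ σ) ≈ W ((zero ∷ map suc B) ∷ shift σ) + stepWeight (suc j) (W ∘ (map suc B ∷_)) σ
    stepWeight-∷ {n} {W} inv j B σ = begin
      W (newBlock (B ∷ σ)) * gap (j ℕ.+ suc (length σ))
        + (W ((zero ∷ B′) ∷ shift σ) + ∑[ π ∈ map (B′ ∷_) (insert (shift σ)) ] W π)
        ≈⟨ +-cong (*-cong (inv swap) (≈-reflexive (cong gap (+-suc j (length σ)))))
                  (+-congˡ (≈-reflexive (∑-map W (B′ ∷_) (insert (shift σ))))) ⟩
      W (B′ ∷ newBlock σ) * gap (suc j ℕ.+ length σ)
        + (W ((zero ∷ B′) ∷ shift σ) + ∑[ π ∈ insert (shift σ) ] W (B′ ∷ π))
        ≈⟨ x+[y+z]≈y+[x+z] _ _ _ ⟩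
      W ((zero ∷ B′) ∷ shift σ) + stepWeight (suc j) (W ∘ (B′ ∷_)) σ ∎
      where
      B′ : List (Fin (suc n))
      B′ = map suc B

    stepWeight-swap : ∀ {W : Weight (suc n)} → Invariant W →
      ∀ j B C σ → stepWeight j W (B ∷ C ∷ σ) ≈ stepWeight j W (C ∷ B ∷ σ)
    stepWeight-swap {n} {W} inv j B C σ = begin
      stepWeight j W (B ∷ C ∷ σ)
        ≈⟨ ≈-trans (stepWeight-∷ inv j B (C ∷ σ)) (+-congˡ (stepWeight-∷ (invariant-∷ _ inv) (suc j) C σ)) ⟩
      W ((zero ∷ B′) ∷ C′ ∷ shift σ) + (W (B′ ∷ (zero ∷ C′) ∷ shift σ) + rest B′ C′)
        ≈⟨ +-cong (inv swap) (+-cong (inv swap) (stepWeight-cong (λ _ → inv swap) (2 ℕ.+ j) σ)) ⟩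
      W (C′ ∷ (zero ∷ B′) ∷ shift σ) + (W ((zero ∷ C′) ∷ B′ ∷ shift σ) + rest C′ B′)
        ≈⟨ x+[y+z]≈y+[x+z] _ _ _ ⟩
      W ((zero ∷ C′) ∷ B′ ∷ shift σ) + (W (C′ ∷ (zero ∷ B′) ∷ shift σ) + rest C′ B′)
        ≈⟨ ≈-trans (stepWeight-∷ inv j C (B ∷ σ)) (+-congˡ (stepWeight-∷ (invariant-∷ _ inv) (suc j) B σ)) ⟨
      stepWeight j W (C ∷ B ∷ σ) ∎
      where
      B′ C′ : List (Fin (suc n))
      B′ = map suc B
      C′ = map suc C
      rest : List (Fin (suc n)) → List (Fin (suc n)) → Carrier
      rest X Y = stepWeight (2 ℕ.+ j) (W ∘ (X ∷_) ∘ (Y ∷_)) σ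

    -- Putting vertex 0 into the empty block repeats the new-block term, which moves the gap back by one.
    stepWeight-dropEmpty : ∀ {W : Weight (suc n)} → Invariant W →
      ∀ j σ → stepWeight j W ([] ∷ σ) ≈ stepWeight j W σ
    stepWeight-dropEmpty {W = W} inv j σ = begin
      stepWeight j W ([] ∷ σ)
        ≈⟨ stepWeight-∷ inv j [] σ ⟩
      W (newBlock σ) + (W ([] ∷ newBlock σ) * gap (suc j ℕ.+ length σ) + ∑[ π ∈ insert (shift σ) ] W ([] ∷ π))
        ≈⟨ +-congˡ (+-cong (*-congʳ (inv dropEmpty)) (∑-cong (λ _ → inv dropEmpty) (insert (shift σ)))) ⟩
      W (newBlock σ) + (W (newBlock σ) * gap (suc (j ℕ.+ length σ)) + ∑[ π ∈ insert (shift σ) ] W π)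
        ≈⟨ absorb (gap-suc (j ℕ.+ length σ)) ⟩
      stepWeight j W σ ∎
      where
      absorb : ∀ {a g′ g s} → g′ + 1# ≈ g → a + (a * g′ + s) ≈ a * g + s
      absorb {a} {g′} {g} {s} g′+1≈g = begin
        a + (a * g′ + s)       ≈⟨ x+[y+z]≈y+[x+z] a (a * g′) s ⟩
        a * g′ + (a + s)       ≈⟨ +-congˡ (+-congʳ (*-identityʳ a)) ⟨
        a * g′ + (a * 1# + s)  ≈⟨ +-assoc _ _ s ⟨
        (a * g′ + a * 1#) + s  ≈⟨ +-congʳ (distribˡ a g′ 1#) ⟨
        a * (g′ + 1#) + s      ≈⟨ +-congʳ (*-congˡ g′+1≈g) ⟩
        a * g + s              ∎

    stepWeight-invariant : ∀ {W : Weight (suc n)} → Invariant W → ∀ j → Invariant (stepWeight j W)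
    stepWeight-invariant inv j (swap {B} {C} {σ}) = stepWeight-swap inv j B C σ
    stepWeight-invariant inv j (dropEmpty {σ})    = stepWeight-dropEmpty inv j σ
    stepWeight-invariant {W = W} inv j (prep {B} {σ} {μ} p) = begin
      stepWeight j W (B ∷ σ)
        ≈⟨ stepWeight-∷ inv j B σ ⟩
      W ((zero ∷ map suc B) ∷ shift σ) + stepWeight (suc j) W′ σ
        ≈⟨ +-cong (inv (prep (⇝-map suc p))) (stepWeight-invariant (invariant-∷ _ inv) (suc j) p) ⟩
      W ((zero ∷ map suc B) ∷ shift μ) + stepWeight (suc j) W′ μ
        ≈⟨ stepWeight-∷ inv j B μ ⟨
      stepWeight j W (B ∷ μ) ∎
      where
      W′ : Weight (suc _)
      W′ = W ∘ (map suc B ∷_)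

    ∑-concatMap-step : (W : Weight (suc n)) (σs : List (Partition n)) →
      ∑[ π ∈ concatMap step σs ] weighted W π ≈ ∑[ σ ∈ σs ] weighted (stepWeight 0 W) σ
    ∑-concatMap-step W σs = ≈-trans (∑-concatMap (weighted W) step σs) (∑-cong (∑-step W) σs)

    ∑-partitionsWith : ∀ m {W : Weight m} → Invariant W → (ρ : Partition 0) →
      ∑[ π ∈ partitionsWith m ρ ] weighted W π ≈ falling R t (length ρ) * ∑[ π ∈ partitions m ] weighted W π
    ∑-partitionsWith zero {W} inv ρ = begin
      W ρ * falling R t (length ρ) + 0#      ≈⟨ +-congʳ (*-congʳ (invariant-empty inv ρ)) ⟩
      W [] * falling R t (length ρ) + 0#     ≈⟨ +-congʳ (*-comm _ _) ⟩
      falling R t (length ρ) * W [] + 0#     ≈⟨ +-congʳ (*-congˡ (*-identityʳ (W []))) ⟨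
      falling R t (length ρ) * (W [] * 1#) + 0#  ≈⟨ ∑-*ˡ _ (weighted W) (partitions 0) ⟩
      falling R t (length ρ) * ∑[ π ∈ partitions 0 ] weighted W π ∎
    ∑-partitionsWith (suc m) {W} inv ρ = begin
      ∑[ π ∈ concatMap step (partitionsWith m ρ) ] weighted W π       ≈⟨ ∑-concatMap-step W (partitionsWith m ρ) ⟩
      ∑[ σ ∈ partitionsWith m ρ ] weighted (stepWeight 0 W) σ         ≈⟨ ∑-partitionsWith m (stepWeight-invariant inv 0) ρ ⟩
      falling R t (length ρ) * ∑[ σ ∈ partitions m ] weighted (stepWeight 0 W) σ
        ≈⟨ *-congˡ (∑-concatMap-step W (partitions m)) ⟨
      falling R t (length ρ) * ∑[ π ∈ concatMap step (partitions m) ] weighted W π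
        ≡⟨ cong (λ πs → falling R t (length ρ) * ∑[ π ∈ πs ] weighted W π) (partitions-suc m) ⟨
      falling R t (length ρ) * ∑[ π ∈ partitions (suc m) ] weighted W π ∎

  module _ (q t : Carrier) where

    graphWeight : Graph n → Weight n
    graphWeight G π = pow R q ⟨ G ∶ π ⟩

    pow-+ : ∀ a b → pow R q (a ℕ.+ b) ≈ pow R q a * pow R q b
    pow-+ zero    b = ≈-sym (*-identityˡ _)
    pow-+ (suc a) b = ≈-trans (*-congʳ (pow-+ a b)) (xy∙z≈xz∙y _ _ _)

    graphWeight-invariant : (G : Graph n) → Invariant (graphWeight G)
    graphWeight-invariant G p = ≈-reflexive (cong (pow R q) (⟨⟩-⇝ G p))

    weighted-⊎G : ∀ {m k} (G : Graph m) (H : Graph k) (τ : Partition k) (π : Partition (m ℕ.+ k)) → Extends m τ π →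
      weighted t (graphWeight (G ⊎G H)) π ≈ graphWeight H τ * weighted t (graphWeight G) (restrictˡ m π)
    weighted-⊎G {m} G H τ π hτ = begin
      pow R q ⟨ G ⊎G H ∶ π ⟩ * falling R t (length π)
        ≡⟨ cong₂ (λ e L → pow R q e * falling R t L) (⟨⟩-⊎G G H τ π hτ) (sym (length-map _ π)) ⟩
      pow R q (⟨ G ∶ restrictˡ m π ⟩ ℕ.+ ⟨ H ∶ τ ⟩) * falling R t (length (restrictˡ m π))
        ≈⟨ *-congʳ (pow-+ ⟨ G ∶ restrictˡ m π ⟩ ⟨ H ∶ τ ⟩) ⟩
      (pow R q ⟨ G ∶ restrictˡ m π ⟩ * pow R q ⟨ H ∶ τ ⟩) * falling R t (length (restrictˡ m π))
        ≈⟨ xy∙z≈y∙xz _ _ _ ⟩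
      pow R q ⟨ H ∶ τ ⟩ * (pow R q ⟨ G ∶ restrictˡ m π ⟩ * falling R t (length (restrictˡ m π))) ∎

    ∑-extensions : ∀ {m k} (G : Graph m) (H : Graph k) (τ : Partition k) →
      ∑[ π ∈ extensions m τ ] weighted t (graphWeight (G ⊎G H)) π ≈ graphWeight H τ * (falling R t (length τ) * Z R G q t)
    ∑-extensions {m} G H τ = begin
      ∑[ π ∈ extensions m τ ] weighted t (graphWeight (G ⊎G H)) π
        ≈⟨ ∑-congᴬ (All.map (weighted-⊎G G H τ _) (extensions-extend m τ)) ⟩
      ∑[ π ∈ extensions m τ ] (graphWeight H τ * weighted t (graphWeight G) (restrictˡ m π))
        ≈⟨ ∑-*ˡ _ _ (extensions m τ) ⟩
      graphWeight H τ * ∑[ π ∈ extensions m τ ] weighted t (graphWeight G) (restrictˡ m π)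
        ≡⟨ cong (graphWeight H τ *_) (∑-map (weighted t (graphWeight G)) (restrictˡ m) (extensions m τ)) ⟨
      graphWeight H τ * ∑[ σ ∈ map (restrictˡ m) (extensions m τ) ] weighted t (graphWeight G) σ
        ≡⟨ cong (λ σs → graphWeight H τ * ∑[ σ ∈ σs ] weighted t (graphWeight G) σ) (restrictˡ-extensions m τ) ⟩
      graphWeight H τ * ∑[ σ ∈ partitionsWith m (restrictˡ 0 τ) ] weighted t (graphWeight G) σ
        ≈⟨ *-congˡ (∑-partitionsWith t m (graphWeight-invariant G) (restrictˡ 0 τ)) ⟩
      graphWeight H τ * (falling R t (length (restrictˡ 0 τ)) * Z R G q t)
        ≡⟨ cong (λ L → graphWeight H τ * (falling R t L * Z R G q t)) (length-map _ τ) ⟩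
      graphWeight H τ * (falling R t (length τ) * Z R G q t) ∎

proposition1p2 : ∀ {c ℓ : Level} (R : CommutativeRing c ℓ) {m k : ℕ}
    (G : Graph m) (H : Graph k) (q t : CommutativeRing.Carrier R) →
    CommutativeRing._≈_ R (Z R (G ⊎G H) q t) (CommutativeRing._*_ R (Z R G q t) (Z R H q t))
proposition1p2 R {m} {k} G H q t = begin
  ∑[ π ∈ partitions (m ℕ.+ k) ] weighted t (graphWeight q t (G ⊎G H)) π
    ≡⟨ cong (λ πs → ∑[ π ∈ πs ] weighted t (graphWeight q t (G ⊎G H)) π) (partitions-+ m k) ⟩
  ∑[ π ∈ concatMap (extensions m) (partitions k) ] weighted t (graphWeight q t (G ⊎G H)) π
    ≈⟨ ∑-concatMap _ (extensions m) (partitions k) ⟩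
  ∑[ τ ∈ partitions k ] ∑[ π ∈ extensions m τ ] weighted t (graphWeight q t (G ⊎G H)) π
    ≈⟨ ∑-cong (∑-extensions q t G H) (partitions k) ⟩
  ∑[ τ ∈ partitions k ] (graphWeight q t H τ * (falling R t (length τ) * Z R G q t))
    ≈⟨ ∑-cong (λ τ → x∙yz≈z∙xy _ _ _) (partitions k) ⟩
  ∑[ τ ∈ partitions k ] (Z R G q t * weighted t (graphWeight q t H) τ)
    ≈⟨ ∑-*ˡ _ _ (partitions k) ⟩
  Z R G q t * Z R H q t ∎
  where
  open CommutativeRing R
  open WeightedSums R
  open import Relation.Binary.Reasoning.Setoid setoid
  open import Algebra.Properties.CommutativeSemigroup *-commutativeSemigroup using (x∙yz≈z∙xy)
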